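{- Let $k\ge1$ and let $G$ be a (simple) graph on $2k$ vertices such that every complete subgraph of $G$ has at most $k$ vertices. Then $G$ contains at least $\left[\frac{k+1}{2}\right]$ pairwise disjoint pairs of non-adjacent vertices. Moreover this bound is sharp: there exist such graphs in which every maximal-cardinality set of pairwise disjoint pairs of non-adjacent vertices has exactly $\left[\frac{k+1}{2}\right]$ elements.
   Context: $[x]$ denotes the integer part of $x$. Two pairs of vertices are disjoint if they share no vertex; a pair is non-adjacent (disconnected) if not joined by an edge. -}

module Defs where

open import Data.Nat using (ℕ; _≤_)
open import Data.Bool using (Bool; true; false)
open import Data.Fin using (Fin)
open import Data.Product using (_×_; _,_)
open import Data.List using (List; []; _∷_; concatMap; length)
open import Data.List.Membership.Propositional using (_∈_)
open import Data.List.Relation.Unary.All using (All)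
open import Data.List.Relation.Unary.Unique.Propositional using (Unique)
open import Relation.Binary.PropositionalEquality using (_≡_; _≢_)

record SimpleGraph (n : ℕ) : Set where
  field
    adj    : Fin n → Fin n → Bool
    sym    : ∀ u v → adj u v ≡ adj v u
    irrefl : ∀ v → adj v v ≡ false
open SimpleGraph public

IsClique : ∀ {n} → SimpleGraph n → List (Fin n) → Set
IsClique G vs =
  Unique vs × (∀ {u v} → u ∈ vs → v ∈ vs → u ≢ v → adj G u v ≡ true)

CliqueBound : ∀ {n} → SimpleGraph n → ℕ → Set
CliqueBound G k = ∀ vs → IsClique G vs → length vs ≤ k

endpoints : ∀ {n} → List (Fin n × Fin n) → List (Fin n)
endpoints = concatMap (λ { (u , v) → u ∷ v ∷ [] })

-- A set of pairwise disjoint pairs of non-adjacent vertices: the endpoints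
-- are all distinct (so pairs are disjoint and each pair has two distinct
-- vertices), and each pair is non-adjacent.
IsDisjointNonAdjPairs : ∀ {n} → SimpleGraph n → List (Fin n × Fin n) → Set
IsDisjointNonAdjPairs G ps =
  Unique (endpoints ps) × All (λ { (u , v) → adj G u v ≡ false }) ps

{-# OPTIONS --safe #-}
-- Greedily match vertices of G along non-edges: each new vertex is paired with a
-- non-neighbour among the so far unmatched vertices if there is one, and otherwise
-- joins them.  The unmatched vertices therefore always form a clique, so at most k
-- of the 2k vertices stay unmatched and at least ⌈k/2⌉ pairs are found.  For
-- sharpness, take the complement of K_{k+1} plus k-1 isolated vertices: every
-- non-edge lies inside the k+1 "low" vertices, so at most ⌊(k+1)/2⌋ disjoint
-- non-edges exist, while a clique contains at most one low vertex.
module Submission where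

open import Defs
open import Data.Bool using (Bool; true; false)
open import Data.Fin using (Fin; toℕ)
open import Data.Fin.Properties using (toℕ-injective; toℕ<n) renaming (_≟_ to _≟ᶠ_)
open import Data.List using (List; []; _∷_; _++_; [_]; length; map; allFin)
open import Data.List.Properties using (length-++; length-map; length-tabulate; length-upTo)
open import Data.List.Membership.Propositional using (_∈_)
open import Data.List.Membership.Propositional.Properties using (∈-∃++; ∈-upTo⁺)
open import Data.List.Relation.Binary.Permutation.Propositional
  using (_↭_; refl; prep; trans; ↭-sym; ↭⇒↭ₛ; module PermutationReasoning)
open import Data.List.Relation.Binary.Permutation.Propositional.Properties
  using (∈-resp-↭; ↭-length; shift; ++⁺ˡ)
open import Data.List.Relation.Binary.Subset.Propositional using (_⊆_)
open import Data.List.Relation.Unary.All as All using (All; []; _∷_)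
import Data.List.Relation.Unary.All.Properties as Allₚ
open import Data.List.Relation.Unary.AllPairs using ([]; _∷_)
open import Data.List.Relation.Unary.Any using (here; there)
open import Data.List.Relation.Unary.Unique.Propositional using (Unique)
open import Data.List.Relation.Unary.Unique.Propositional.Properties using (allFin⁺)
import Data.List.Relation.Unary.Unique.Propositional.Properties as Unique
import Data.List.Relation.Binary.Permutation.Setoid.Properties as PermutationSetoid
open import Data.Nat using (ℕ; suc; _+_; _*_; _∸_; _≤_; _<_; _≤?_; z≤n; s≤s; ⌊_/2⌋; ⌈_/2⌉; >-nonZero)
open import Data.Nat.Properties
open import Data.Product using (Σ; ∃-syntax; _×_; _,_)
open import Data.Sum using (_⊎_; inj₁; inj₂)
open import Relation.Binary.PropositionalEquality
  using (_≡_; _≢_; refl; cong; subst; setoid; module ≡-Reasoning)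
  renaming (sym to ≡-sym; trans to ≡-trans)
open import Relation.Nullary using (yes; no; contradiction)

Unique-resp-↭ : ∀ {A : Set} {xs ys : List A} → xs ↭ ys → Unique xs → Unique ys
Unique-resp-↭ {A} p = PermutationSetoid.Unique-resp-↭ (setoid A) (↭⇒↭ₛ p)

Unique-++⁻ : ∀ {A : Set} (xs : List A) {ys} → Unique (xs ++ ys) → Unique xs × Unique ys
Unique-++⁻ []       ys!                  = [] , ys!
Unique-++⁻ (x ∷ xs) (x∉xs++ys ∷ xs++ys!) with xs! , ys! ← Unique-++⁻ xs xs++ys! =
  Allₚ.++⁻ˡ xs x∉xs++ys ∷ xs! , ys!

Unique-map⁺ : ∀ {A B : Set} (f : A → B) {xs} →
              (∀ {x y} → x ∈ xs → y ∈ xs → x ≢ y → f x ≢ f y) →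
              Unique xs → Unique (map f xs)
Unique-map⁺ f {[]}     f-inj []           = []
Unique-map⁺ f {x ∷ xs} f-inj (x∉xs ∷ xs!) =
  Allₚ.map⁺ (All.tabulate λ y∈xs → f-inj (here refl) (there y∈xs) (All.lookup x∉xs y∈xs))
  ∷ Unique-map⁺ f (λ x∈ y∈ → f-inj (there x∈) (there y∈)) xs!

Unique∧⊆⇒length≤ : ∀ {A : Set} {xs ys : List A} → Unique xs → xs ⊆ ys → length xs ≤ length ys
Unique∧⊆⇒length≤ [] _ = z≤n
Unique∧⊆⇒length≤ {xs = x ∷ xs} (x∉xs ∷ xs!) xs⊆ys
  with as , bs , refl ← ∈-∃++ (xs⊆ys (here refl)) = begin
    suc (length xs)            ≤⟨ s≤s (Unique∧⊆⇒length≤ xs! xs⊆as++bs) ⟩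
    suc (length (as ++ bs))    ≡⟨ ↭-length (shift x as bs) ⟨
    length (as ++ [ x ] ++ bs) ∎
  where
  open ≤-Reasoning
  xs⊆as++bs : xs ⊆ as ++ bs
  xs⊆as++bs y∈xs with ∈-resp-↭ (shift x as bs) (xs⊆ys (there y∈xs))
  ... | here y≡x = contradiction (≡-sym y≡x) (All.lookup x∉xs y∈xs)
  ... | there y∈ = y∈

Unique∧All<⇒length≤ : ∀ {m} {xs : List ℕ} → Unique xs → All (_< m) xs → length xs ≤ m
Unique∧All<⇒length≤ {m} xs! xs<m =
  subst (_ ≤_) (length-upTo m) (Unique∧⊆⇒length≤ xs! (λ x∈xs → ∈-upTo⁺ (All.lookup xs<m x∈xs)))

n≤m+m⇒⌈n/2⌉≤m : ∀ {m n} → n ≤ m + m → ⌈ n /2⌉ ≤ m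
n≤m+m⇒⌈n/2⌉≤m {m} n≤m+m = ≤-trans (⌈n/2⌉-mono n≤m+m) (≤-reflexive (≡-sym (n≡⌈n+n/2⌉ m)))

m+m≤n⇒m≤⌊n/2⌋ : ∀ {m n} → m + m ≤ n → m ≤ ⌊ n /2⌋
m+m≤n⇒m≤⌊n/2⌋ {m} m+m≤n = ≤-trans (≤-reflexive (n≡⌊n+n/2⌋ m)) (⌊n/2⌋-mono m+m≤n)

length-endpoints : ∀ {n} (ps : List (Fin n × Fin n)) → length (endpoints ps) ≡ length ps + length ps
length-endpoints []       = refl
length-endpoints (_ ∷ ps) =
  cong suc (≡-trans (cong suc (length-endpoints ps)) (≡-sym (+-suc (length ps) (length ps))))

module Greedy {n} (G : SimpleGraph n) where

  NonAdjacent : Fin n × Fin n → Set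
  NonAdjacent (u , v) = adj G u v ≡ false

  Complete : List (Fin n) → Set
  Complete cs = ∀ {u v} → u ∈ cs → v ∈ cs → u ≢ v → adj G u v ≡ true

  record MatchingCliqueSplit (xs : List (Fin n)) : Set where
    constructor mkSplit
    field
      pairs       : List (Fin n × Fin n)
      clique      : List (Fin n)
      split       : endpoints pairs ++ clique ↭ xs
      nonAdjacent : All NonAdjacent pairs
      complete    : Complete clique

  nonNeighbour? : ∀ v cs → (∃[ c ] c ∈ cs × adj G c v ≡ false) ⊎ All (λ c → adj G c v ≡ true) cs
  nonNeighbour? v []       = inj₂ []
  nonNeighbour? v (c ∷ cs) with adj G c v in c~v | nonNeighbour? v cs
  ... | false | _                     = inj₁ (c , here refl , c~v)
  ... | true  | inj₁ (d , d∈cs , d≁v) = inj₁ (d , there d∈cs , d≁v)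
  ... | true  | inj₂ cs~v             = inj₂ (c~v ∷ cs~v)

  extend : ∀ {xs} v → MatchingCliqueSplit xs → MatchingCliqueSplit (v ∷ xs)
  extend {xs} v (mkSplit ps cs split nonAdj complete) with nonNeighbour? v cs
  ... | inj₁ (c , c∈cs , c≁v) with as , bs , refl ← ∈-∃++ c∈cs =
    mkSplit ((c , v) ∷ ps) (as ++ bs) split′ (c≁v ∷ nonAdj) complete′
    where
    open PermutationReasoning
    E : List (Fin n)
    E = endpoints ps
    split′ : c ∷ v ∷ E ++ as ++ bs ↭ v ∷ xs
    split′ = begin
      c ∷ v ∷ E ++ as ++ bs     <<⟨ refl ⟩
      v ∷ c ∷ E ++ as ++ bs     ↭⟨ prep v (↭-sym (shift c E (as ++ bs))) ⟩
      v ∷ E ++ c ∷ as ++ bs     ↭⟨ prep v (++⁺ˡ E (↭-sym (shift c as bs))) ⟩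
      v ∷ E ++ as ++ c ∷ bs     ↭⟨ prep v split ⟩
      v ∷ xs                    ∎
    as++bs⊆cs : as ++ bs ⊆ as ++ [ c ] ++ bs
    as++bs⊆cs u∈ = ∈-resp-↭ (↭-sym (shift c as bs)) (there u∈)
    complete′ : Complete (as ++ bs)
    complete′ u∈ w∈ = complete (as++bs⊆cs u∈) (as++bs⊆cs w∈)
  ... | inj₂ cs~v = mkSplit ps (v ∷ cs) (trans (shift v (endpoints ps) cs) (prep v split)) nonAdj complete′
    where
    complete′ : Complete (v ∷ cs)
    complete′ (here refl) (here refl) v≢v = contradiction refl v≢v
    complete′ (here refl) (there w∈)  _   = ≡-trans (SimpleGraph.sym G v _) (All.lookup cs~v w∈)
    complete′ (there u∈)  (here refl) _   = All.lookup cs~v u∈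
    complete′ (there u∈)  (there w∈)      = complete u∈ w∈

  greedy : ∀ xs → MatchingCliqueSplit xs
  greedy []       = mkSplit [] [] refl [] (λ ())
  greedy (x ∷ xs) = extend x (greedy xs)

disjointNonAdjPairs-lowerBound : ∀ k (G : SimpleGraph (2 * k)) → CliqueBound G k →
  Σ (List (Fin (2 * k) × Fin (2 * k))) (λ ps → IsDisjointNonAdjPairs G ps × ⌈ k /2⌉ ≤ length ps)
disjointNonAdjPairs-lowerBound k G cliqueBound
  with Greedy.mkSplit ps cs split nonAdj complete ← Greedy.greedy G (allFin (2 * k))
  with ps! , cs! ← Unique-++⁻ (endpoints ps) (Unique-resp-↭ (↭-sym split) (allFin⁺ (2 * k))) =
  -- NonAdjacent and the pattern lambda in IsDisjointNonAdjPairs agree only on pairs (u , v).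
  ps , (ps! , All.map (λ { {_ , _} u≁v → u≁v }) nonAdj) , n≤m+m⇒⌈n/2⌉≤m k≤m+m
  where
  m : ℕ
  m = length ps
  2m+|cs|≡2k : (m + m) + length cs ≡ k + k
  2m+|cs|≡2k = begin
    (m + m) + length cs                    ≡⟨ cong (_+ length cs) (length-endpoints ps) ⟨
    length (endpoints ps) + length cs      ≡⟨ length-++ (endpoints ps) ⟨
    length (endpoints ps ++ cs)            ≡⟨ ↭-length split ⟩
    length (allFin (2 * k))                ≡⟨ length-tabulate {n = 2 * k} (λ i → i) ⟩
    k + (k + 0)                            ≡⟨ cong (k +_) (+-identityʳ k) ⟩
    k + k                                  ∎
    where open ≡-Reasoning
  k≤m+m : k ≤ m + m
  k≤m+m = +-cancelʳ-≤ k k (m + m) (begin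
    k + k               ≡⟨ 2m+|cs|≡2k ⟨
    (m + m) + length cs ≤⟨ +-monoʳ-≤ (m + m) (cliqueBound cs (cs! , complete)) ⟩
    (m + m) + k         ∎)
    where open ≤-Reasoning

module Extremal (k : ℕ) where

  Low : Fin (2 * k) → Set
  Low x = toℕ x ≤ k

  extremalAdj : Fin (2 * k) → Fin (2 * k) → Bool
  extremalAdj u v with u ≟ᶠ v | toℕ u ≤? k | toℕ v ≤? k
  ... | yes _ | _     | _     = false
  ... | no _  | yes _ | yes _ = false
  ... | no _  | _     | _     = true

  extremalAdj-sym : ∀ u v → extremalAdj u v ≡ extremalAdj v u
  extremalAdj-sym u v with u ≟ᶠ v | v ≟ᶠ u | toℕ u ≤? k | toℕ v ≤? k
  ... | yes _   | yes _   | _     | _     = refl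
  ... | yes u≡v | no v≢u  | _     | _     = contradiction (≡-sym u≡v) v≢u
  ... | no u≢v  | yes v≡u | _     | _     = contradiction (≡-sym v≡u) u≢v
  ... | no _    | no _    | yes _ | yes _ = refl
  ... | no _    | no _    | yes _ | no _  = refl
  ... | no _    | no _    | no _  | yes _ = refl
  ... | no _    | no _    | no _  | no _  = refl

  extremalAdj-irrefl : ∀ v → extremalAdj v v ≡ false
  extremalAdj-irrefl v with v ≟ᶠ v
  ... | yes _  = refl
  ... | no v≢v = contradiction refl v≢v

  extremal : SimpleGraph (2 * k)
  extremal = record { adj = extremalAdj ; sym = extremalAdj-sym ; irrefl = extremalAdj-irrefl }

  nonAdjacent⇒Low : ∀ {u v} → extremalAdj u v ≡ false → u ≢ v → Low u × Low v
  nonAdjacent⇒Low {u} {v} u≁v u≢v with u ≟ᶠ v | toℕ u ≤? k | toℕ v ≤? k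
  ... | yes u≡v | _       | _       = contradiction u≡v u≢v
  ... | no _    | yes u≤k | yes v≤k = u≤k , v≤k
  ... | no _    | yes _   | no _    = contradiction u≁v λ ()
  ... | no _    | no _    | _       = contradiction u≁v λ ()

  Low⇒nonAdjacent : ∀ {u v} → Low u → Low v → extremalAdj u v ≡ false
  Low⇒nonAdjacent {u} {v} u≤k v≤k with u ≟ᶠ v | toℕ u ≤? k | toℕ v ≤? k
  ... | yes _ | _      | _      = refl
  ... | no _  | yes _  | yes _  = refl
  ... | no _  | yes _  | no v≰k = contradiction v≤k v≰k
  ... | no _  | no u≰k | _      = contradiction u≤k u≰k

  -- x ↦ toℕ x ∸ k sends all low vertices to 0 and is injective on the others,
  -- and a clique contains at most one low vertex.
  extremal-cliqueBound : 1 ≤ k → CliqueBound extremal k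
  extremal-cliqueBound 1≤k vs (vs! , complete) =
    subst (_≤ k) (length-map f vs)
      (Unique∧All<⇒length≤ (Unique-map⁺ f f-inj vs!) (Allₚ.map⁺ (All.tabulate λ {x} _ → f<k x)))
    where
    f : Fin (2 * k) → ℕ
    f x = toℕ x ∸ k
    f<k : ∀ x → f x < k
    f<k x = m<n+o⇒m∸n<o (toℕ x) k {{>-nonZero 1≤k}}
              (subst (toℕ x <_) (cong (k +_) (+-identityʳ k)) (toℕ<n x))
    f-inj : ∀ {x y} → x ∈ vs → y ∈ vs → x ≢ y → f x ≢ f y
    f-inj {x} {y} x∈ y∈ x≢y fx≡fy with toℕ x ≤? k | toℕ y ≤? k
    ... | yes x≤k | yes y≤k =
      contradiction (≡-trans (≡-sym (complete x∈ y∈ x≢y)) (Low⇒nonAdjacent x≤k y≤k)) λ ()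
    ... | yes x≤k | no y≰k  = y≰k (m∸n≡0⇒m≤n (≡-trans (≡-sym fx≡fy) (m≤n⇒m∸n≡0 x≤k)))
    ... | no x≰k  | yes y≤k = x≰k (m∸n≡0⇒m≤n (≡-trans fx≡fy (m≤n⇒m∸n≡0 y≤k)))
    ... | no x≰k  | no y≰k  = x≢y (toℕ-injective (∸-cancelʳ-≡ (≰⇒≥ x≰k) (≰⇒≥ y≰k) fx≡fy))

  endpoints-Low : ∀ ps → IsDisjointNonAdjPairs extremal ps → All Low (endpoints ps)
  endpoints-Low []             _ = []
  endpoints-Low ((u , v) ∷ ps) ((u∉ ∷ _ ∷ ps!) , (u≁v ∷ nonAdj))
    with u≤k , v≤k ← nonAdjacent⇒Low u≁v (All.head u∉) =
    u≤k ∷ v≤k ∷ endpoints-Low ps (ps! , nonAdj)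

  extremal-upperBound : ∀ ps → IsDisjointNonAdjPairs extremal ps → length ps ≤ ⌊ suc k /2⌋
  extremal-upperBound ps matching@(ps! , _) = m+m≤n⇒m≤⌊n/2⌋ (begin
    length ps + length ps              ≡⟨ length-endpoints ps ⟨
    length (endpoints ps)              ≡⟨ length-map toℕ (endpoints ps) ⟨
    length (map toℕ (endpoints ps))    ≤⟨ Unique∧All<⇒length≤ (Unique.map⁺ toℕ-injective ps!)
                                            (Allₚ.map⁺ (All.map s≤s (endpoints-Low ps matching))) ⟩
    suc k                              ∎)
    where open ≤-Reasoning

lemma3p1 :
  ((k : ℕ) → 1 ≤ k → (G : SimpleGraph (2 * k)) → CliqueBound G k →
    Σ (List (Fin (2 * k) × Fin (2 * k))) (λ ps →
      IsDisjointNonAdjPairs G ps × ⌊ suc k /2⌋ ≤ length ps))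
  ×
  ((k : ℕ) → 1 ≤ k →
    Σ (SimpleGraph (2 * k)) (λ G → CliqueBound G k ×
      ((ps : List (Fin (2 * k) × Fin (2 * k))) →
        IsDisjointNonAdjPairs G ps → length ps ≤ ⌊ suc k /2⌋)))
lemma3p1 =
  (λ k _ → disjointNonAdjPairs-lowerBound k) ,
  (λ k 1≤k → Extremal.extremal k , Extremal.extremal-cliqueBound k 1≤k , Extremal.extremal-upperBound k)
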